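{- The following identities of formal power series in $q$ hold: \begin{align*} \sum_{n=0}^{\infty} \frac{z^nq^{n^2+n}}{(q;q^2)_{n+1}}&=\sum_{n=0}^{\infty}(-zq;q^2)_n q^n,\\ \sum_{n=0}^{\infty} \frac{z^nq^{n^2+n}}{(zq;q^2)_{n+1}}&=\sum_{n=0}^{\infty}(-q;q^2)_n(zq)^n,\\ \sum_{n=0}^{\infty}\frac{q^{n^2+n}}{(zq;q^2)_{n+1}}&=\sum_{n=0}^{\infty}(-q/z;q^2)_n(zq)^n,\\ \sum_{n=0}^{\infty} \frac{z^{2n} q^{n^2+n}}{(zq;q^2)_{n+1}}&=\sum_{n=0}^{\infty}(-zq;q^2)_n(zq)^n. \end{align*}
   Context: $(a;q)_0:=1$ and $(a;q)_n:=(1-a)(1-aq)\cdots(1-aq^{n-1})$ for $n\ge1$. Here $z$ is an indeterminate. -}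

module Defs where

open import Level using (_⊔_)
open import Algebra.Bundles using (CommutativeRing)
open import Data.Nat using (ℕ; zero; suc; _∸_; _≤?_; _≟_)
open import Relation.Nullary using (yes; no)

module PowerSeries {c ℓ} (R : CommutativeRing c ℓ) where
  open CommutativeRing R

  -- a formal power series is its coefficient sequence: f N = [q^N] f
  Series : Set c
  Series = ℕ → Carrier

  infix 4 _≋_
  _≋_ : Series → Series → Set ℓ
  f ≋ g = ∀ N → f N ≈ g N

  sumTo : ℕ → (ℕ → Carrier) → Carrier
  sumTo zero    f = 0#
  sumTo (suc n) f = sumTo n f + f n

  pow : Carrier → ℕ → Carrier
  pow a zero    = 1#
  pow a (suc n) = a * pow a n

  mono : Carrier → ℕ → Series
  mono a k N with N ≟ k
  ... | yes _ = a
  ... | no  _ = 0#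

  one : Series
  one = mono 1# 0

  q : Series
  q = mono 1# 1

  infixl 6 _⊕_ _⊖_
  infixl 7 _⊛_

  _⊕_ : Series → Series → Series
  (f ⊕ g) N = f N + g N

  _⊖_ : Series → Series → Series
  (f ⊖ g) N = f N - g N

  _⊛_ : Series → Series → Series
  (f ⊛ g) N = sumTo (suc N) (λ i → f i * g (N ∸ i))

  _·_ : Carrier → Series → Series
  (a · f) N = a * f N

  _^ˢ_ : Series → ℕ → Series
  f ^ˢ zero  = one
  f ^ˢ suc n = f ⊛ (f ^ˢ n)

  prodTo : ℕ → (ℕ → Series) → Series
  prodTo zero    F = one
  prodTo (suc n) F = prodTo n F ⊛ F n

  poch : Series → Series → ℕ → Series
  poch a b n = prodTo n (λ k → one ⊖ (a ⊛ (b ^ˢ k)))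

  -- Multiplicative inverse of a series f with constant term 1:
  -- g 0 = 1,  g N = - Σ_{i=1}^{N} f i * g (N - i).
  -- invTable f N j is g j for all j ≤ N.
  invTable : Series → ℕ → ℕ → Carrier
  invTable f zero    j = 1#
  invTable f (suc N) j with j ≤? N
  ... | yes _ = invTable f N j
  ... | no  _ = - sumTo (suc N) (λ i → f (suc i) * invTable f N (N ∸ i))

  inv : Series → Series
  inv f N = invTable f N N

  -- quotient f / g, for g with constant term 1
  _⊘_ : Series → Series → Series
  f ⊘ g = f ⊛ inv g

  -- Infinite sum Σ_{n ≥ 0} F n, for a family in which F n has q-order ≥ n
  -- (only terms n ≤ N can contribute to the coefficient of q^N).
  sumSeries : (ℕ → Series) → Series
  sumSeries F N = sumTo (suc N) (λ n → F n N)

  -- ring operations of R, re-exported under distinct names for the statement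
  Coeff : Set c
  Coeff = Carrier

  infix 4 _≈ᴿ_
  _≈ᴿ_ : Coeff → Coeff → Set ℓ
  _≈ᴿ_ = _≈_

  infixl 7 _*ᴿ_
  _*ᴿ_ : Coeff → Coeff → Coeff
  _*ᴿ_ = _*_

  -ᴿ_ : Coeff → Coeff
  -ᴿ_ = -_

  1ᴿ : Coeff
  1ᴿ = 1#

module Submission where

-- The four identities of the corollary are instances of one master
-- identity: for scalars b, α, a of a commutative ring with α b = a,
--   Σ_n a^n q^{n²+n} / (bq;q²)_{n+1}  =  Σ_n (-αq;q²)_n (bq)^n,
-- namely (b, α, a) = (1, z, z), (z, 1, z), (z, w, 1) with z w = 1, and
-- (z, z, z²).  To prove it, both sides are dilated by a series s (think
-- s = q^{2k}):  F(s) = Σ_n (as)^n q^{n²+n} / (bqs;q²)_{n+1}  and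
-- G(s) = Σ_n (-αq;q²)_n (bqs)^n.  Each satisfies the functional equation
--   (1 - bqs)·H(s) = 1 + a s q²·H(s q²),
-- and since 1 - bqs is a unit and a s q² has positive q-order, this
-- equation has at most one solution: the difference of two solutions has
-- arbitrarily large order.

open import Defs
open import Algebra.Bundles using (CommutativeRing)
open import Data.Product using (_×_; _,_)
open import Data.Sum using (inj₁; inj₂)
open import Data.Nat as ℕ using (ℕ; zero; suc; _∸_; _≤_; _<_; z≤n; s≤s; _≤?_; _<?_)
  renaming (_+_ to _+ℕ_; _*_ to _*ℕ_)
import Data.Nat.Properties as ℕP
open import Data.Nat.Tactic.RingSolver using (solve-∀)
open import Data.Empty using (⊥-elim)
open import Relation.Nullary using (Dec; yes; no)
open import Relation.Binary.PropositionalEquality as ≡ using (_≡_; _≢_)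
open import Relation.Binary.Structures using (IsEquivalence)
import Algebra.Properties.CommutativeSemigroup as CommutativeSemigroupProperties
import Algebra.Properties.Ring as RingProperties
import Algebra.Properties.Group as GroupProperties
import Relation.Binary.Reasoning.Setoid as SetoidReasoning

module CommutativeRingFacts {a ℓ} (S : CommutativeRing a ℓ) where
  open CommutativeRing S
  open SetoidReasoning setoid
  open RingProperties ring using (x[y-z]≈xy-xz; [y-z]x≈yx-zx; -‿distribˡ-*; -‿+-comm)
  open GroupProperties +-group public using (x∙y⁻¹≈ε⇒x≈y)
  open CommutativeSemigroupProperties *-commutativeSemigroup public
    using (x∙yz≈y∙xz) renaming (interchange to *-interchange)
  open CommutativeSemigroupProperties +-commutativeSemigroup
    using (xy∙z≈xz∙y) renaming (interchange to +-interchange)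

  cancel-common-summand : ∀ c x y → (c + x) - (c + y) ≈ x - y
  cancel-common-summand c x y = begin
    (c + x) + - (c + y)    ≈⟨ +-congˡ (-‿+-comm c y) ⟨
    (c + x) + (- c + - y)  ≈⟨ +-interchange c x (- c) (- y) ⟩
    (c - c) + (x - y)      ≈⟨ +-congʳ (-‿inverseʳ c) ⟩
    0# + (x - y)           ≈⟨ +-identityˡ _ ⟩
    x - y                  ∎

  difference-of-solutions : ∀ {u c B F F′ G G′} →
    u * F ≈ c + B * F′ → u * G ≈ c + B * G′ → u * (F - G) ≈ B * (F′ - G′)
  difference-of-solutions {u} {c} {B} {F} {F′} {G} {G′} eqF eqG = begin
    u * (F - G)                   ≈⟨ x[y-z]≈xy-xz u F G ⟩
    u * F - u * G                 ≈⟨ +-cong eqF (-‿cong eqG) ⟩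
    (c + B * F′) - (c + B * G′)   ≈⟨ cancel-common-summand c _ _ ⟩
    B * F′ - B * G′               ≈⟨ x[y-z]≈xy-xz B F′ G′ ⟨
    B * (F′ - G′)                 ∎

  collect-term : ∀ {G X c B H} → G ≈ (c + X * G) + B * H → (1# - X) * G ≈ c + B * H
  collect-term {G} {X} {c} {B} {H} eq = begin
    (1# - X) * G                     ≈⟨ [y-z]x≈yx-zx G 1# X ⟩
    1# * G - X * G                   ≈⟨ +-congʳ (*-identityˡ G) ⟩
    G - X * G                        ≈⟨ +-congʳ eq ⟩
    ((c + X * G) + B * H) - X * G    ≈⟨ +-congʳ (xy∙z≈xz∙y c _ _) ⟩
    ((c + B * H) + X * G) - X * G    ≈⟨ +-assoc _ _ _ ⟩
    (c + B * H) + (X * G - X * G)    ≈⟨ +-congˡ (-‿inverseʳ _) ⟩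
    (c + B * H) + 0#                 ≈⟨ +-identityʳ _ ⟩
    c + B * H                        ∎

  expand-factor : ∀ c w p x y →
    (c * (1# - w * p)) * (x * y) ≈ x * (c * y) + c * ((- (w * x)) * (p * y))
  expand-factor c w p x y = begin
    (c * (1# - w * p)) * (x * y)                ≈⟨ *-congʳ (x[y-z]≈xy-xz c 1# (w * p)) ⟩
    (c * 1# - c * (w * p)) * (x * y)            ≈⟨ distribʳ (x * y) (c * 1#) _ ⟩
    (c * 1#) * (x * y) + (- (c * (w * p))) * (x * y)
      ≈⟨ +-cong (*-congʳ (*-identityʳ c)) (*-congʳ (-‿cong (x∙yz≈y∙xz c w p))) ⟩
    c * (x * y) + (- (w * (c * p))) * (x * y)   ≈⟨ +-cong (x∙yz≈y∙xz c x y) (*-congʳ (-‿distribˡ-* w _)) ⟩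
    x * (c * y) + (- w * (c * p)) * (x * y)     ≈⟨ +-congˡ (*-interchange (- w) (c * p) x y) ⟩
    x * (c * y) + (- w * x) * ((c * p) * y)     ≈⟨ +-congˡ (*-cong (sym (-‿distribˡ-* w x)) (*-assoc c p y)) ⟩
    x * (c * y) + (- (w * x)) * (c * (p * y))   ≈⟨ +-congˡ (x∙yz≈y∙xz _ c _) ⟩
    x * (c * y) + c * ((- (w * x)) * (p * y))   ∎

module PowerSeriesRing {c ℓ} (R : CommutativeRing c ℓ) where
  open CommutativeRing R hiding (zero)
  open PowerSeries R
  open SetoidReasoning setoid
  open CommutativeSemigroupProperties +-commutativeSemigroup
    using () renaming (interchange to +-interchange)

  sumTo-cong : ∀ n {f g : ℕ → Carrier} → (∀ i → i < n → f i ≈ g i) → sumTo n f ≈ sumTo n g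
  sumTo-cong zero    eq = refl
  sumTo-cong (suc n) eq = +-cong (sumTo-cong n (λ i i<n → eq i (ℕP.m<n⇒m<1+n i<n))) (eq n ℕP.≤-refl)

  sumTo-cong′ : ∀ n {f g : ℕ → Carrier} → (∀ i → f i ≈ g i) → sumTo n f ≈ sumTo n g
  sumTo-cong′ n eq = sumTo-cong n (λ i _ → eq i)

  sumTo-zero : ∀ n {f : ℕ → Carrier} → (∀ i → i < n → f i ≈ 0#) → sumTo n f ≈ 0#
  sumTo-zero zero    eq = refl
  sumTo-zero (suc n) eq =
    trans (+-cong (sumTo-zero n (λ i i<n → eq i (ℕP.m<n⇒m<1+n i<n))) (eq n ℕP.≤-refl)) (+-identityʳ 0#)

  sumTo-+ : ∀ n (f g : ℕ → Carrier) → sumTo n (λ i → f i + g i) ≈ sumTo n f + sumTo n g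
  sumTo-+ zero    f g = sym (+-identityʳ 0#)
  sumTo-+ (suc n) f g = trans (+-congʳ (sumTo-+ n f g)) (+-interchange _ _ _ _)

  sumTo-*ˡ : ∀ n a (f : ℕ → Carrier) → a * sumTo n f ≈ sumTo n (λ i → a * f i)
  sumTo-*ˡ zero    a f = zeroʳ a
  sumTo-*ˡ (suc n) a f = trans (distribˡ a _ _) (+-congʳ (sumTo-*ˡ n a f))

  sumTo-*ʳ : ∀ n a (f : ℕ → Carrier) → sumTo n f * a ≈ sumTo n (λ i → f i * a)
  sumTo-*ʳ n a f = trans (*-comm _ a) (trans (sumTo-*ˡ n a f) (sumTo-cong′ n (λ i → *-comm a (f i))))

  sumTo-first : ∀ n (f : ℕ → Carrier) → sumTo (suc n) f ≈ f 0 + sumTo n (λ i → f (suc i))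
  sumTo-first zero    f = trans (+-identityˡ (f 0)) (sym (+-identityʳ (f 0)))
  sumTo-first (suc n) f = trans (+-congʳ (sumTo-first n f)) (+-assoc _ _ _)

  sumTo-extend : ∀ n k {f : ℕ → Carrier} → (∀ i → n ≤ i → f i ≈ 0#) → sumTo (n +ℕ k) f ≈ sumTo n f
  sumTo-extend n zero    {f} vanish rewrite ℕP.+-identityʳ n = refl
  sumTo-extend n (suc k) {f} vanish rewrite ℕP.+-suc n k =
    trans (+-cong (sumTo-extend n k vanish) (vanish (n +ℕ k) (ℕP.m≤m+n n k))) (+-identityʳ _)

  sumTo-extend≤ : ∀ {n m} {f : ℕ → Carrier} → n ≤ m → (∀ i → n ≤ i → f i ≈ 0#) → sumTo m f ≈ sumTo n f
  sumTo-extend≤ {n} {m} {f} n≤m vanish =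
    ≡.subst (λ k → sumTo k f ≈ sumTo n f) (ℕP.m+[n∸m]≡n n≤m) (sumTo-extend n (m ∸ n) vanish)

  sumTo-reverse : ∀ n (f : ℕ → Carrier) → sumTo n f ≈ sumTo n (λ i → f (n ∸ suc i))
  sumTo-reverse zero    f = refl
  sumTo-reverse (suc n) f = begin
    sumTo n f + f n                        ≈⟨ +-comm _ _ ⟩
    f n + sumTo n f                        ≈⟨ +-congˡ (sumTo-reverse n f) ⟩
    f n + sumTo n (λ i → f (n ∸ suc i))    ≈⟨ sumTo-first n (λ i → f (n ∸ i)) ⟨
    sumTo (suc n) (λ i → f (n ∸ i))        ∎

  sumTo-swap : ∀ n m (f : ℕ → ℕ → Carrier) →
    sumTo n (λ i → sumTo m (f i)) ≈ sumTo m (λ j → sumTo n (λ i → f i j))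
  sumTo-swap zero    m f = sym (sumTo-zero m (λ _ _ → refl))
  sumTo-swap (suc n) m f = trans (+-congʳ (sumTo-swap n m f)) (sym (sumTo-+ m _ _))

  sumTo-triangle : ∀ n (F : ℕ → ℕ → Carrier) →
    sumTo n (λ i → sumTo (suc i) (F i)) ≈ sumTo n (λ j → sumTo (n ∸ j) (λ k → F (j +ℕ k) j))
  sumTo-triangle zero    F = refl
  sumTo-triangle (suc n) F = begin
    sumTo n (λ i → sumTo (suc i) (F i)) + (sumTo n (F n) + F n n)
      ≈⟨ +-congʳ (sumTo-triangle n F) ⟩
    sumTo n (λ j → sumTo (n ∸ j) (λ k → F (j +ℕ k) j)) + (sumTo n (F n) + F n n)
      ≈⟨ +-assoc _ _ _ ⟨
    (sumTo n (λ j → sumTo (n ∸ j) (λ k → F (j +ℕ k) j)) + sumTo n (F n)) + F n n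
      ≈⟨ +-cong (sym (sumTo-+ n _ _)) diagonal ⟩
    sumTo n (λ j → sumTo (n ∸ j) (λ k → F (j +ℕ k) j) + F n j) + sumTo (suc n ∸ n) (λ k → F (n +ℕ k) n)
      ≈⟨ +-congʳ (sumTo-cong n row) ⟩
    sumTo n (λ j → sumTo (suc n ∸ j) (λ k → F (j +ℕ k) j)) + sumTo (suc n ∸ n) (λ k → F (n +ℕ k) n) ∎
    where
    diagonal : F n n ≈ sumTo (suc n ∸ n) (λ k → F (n +ℕ k) n)
    diagonal rewrite ℕP.m+n∸n≡m 1 n | ℕP.+-identityʳ n = sym (+-identityˡ _)
    row : ∀ j → j < n → sumTo (n ∸ j) (λ k → F (j +ℕ k) j) + F n j ≈ sumTo (suc n ∸ j) (λ k → F (j +ℕ k) j)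
    row j j<n rewrite ℕP.+-∸-assoc 1 (ℕP.<⇒≤ j<n) | ℕP.m+[n∸m]≡n (ℕP.<⇒≤ j<n) = refl

  sumTo-single : ∀ n k (f : ℕ → Carrier) → (∀ i → i ≢ k → f i ≈ 0#) → k < n → sumTo n f ≈ f k
  sumTo-single (suc n) k f vanish k<1+n with ℕP.m≤n⇒m<n∨m≡n (ℕP.≤-pred k<1+n)
  ... | inj₁ k<n   = trans (+-cong (sumTo-single n k f vanish k<n) (vanish n (λ n≡k → ℕP.<-irrefl (≡.sym n≡k) k<n)))
                           (+-identityʳ _)
  ... | inj₂ ≡.refl = trans (+-congʳ (sumTo-zero n (λ i i<n → vanish i (λ i≡n → ℕP.<-irrefl i≡n i<n))))
                            (+-identityˡ _)

  mono-hit : ∀ a k → mono a k k ≈ a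
  mono-hit a k with k ℕ.≟ k
  ... | yes _  = refl
  ... | no k≢k = ⊥-elim (k≢k ≡.refl)

  mono-miss : ∀ a k N → N ≢ k → mono a k N ≈ 0#
  mono-miss a k N N≢k with N ℕ.≟ k
  ... | yes N≡k = ⊥-elim (N≢k N≡k)
  ... | no _    = refl

  mono-cong : ∀ {a b} k → a ≈ b → mono a k ≋ mono b k
  mono-cong k a≈b N with N ℕ.≟ k
  ... | yes _ = a≈b
  ... | no _  = refl

  mono⊛-≥ : ∀ a k f N → k ≤ N → (mono a k ⊛ f) N ≈ a * f (N ∸ k)
  mono⊛-≥ a k f N k≤N = trans
    (sumTo-single (suc N) k _ (λ i i≢k → trans (*-congʳ (mono-miss a k i i≢k)) (zeroˡ _)) (s≤s k≤N))
    (*-congʳ (mono-hit a k))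

  mono⊛-< : ∀ a k f N → N < k → (mono a k ⊛ f) N ≈ 0#
  mono⊛-< a k f N N<k = sumTo-zero (suc N) (λ i i≤N →
    trans (*-congʳ (mono-miss a k i (λ i≡k → ℕP.<-irrefl i≡k (ℕP.≤-<-trans (ℕP.≤-pred i≤N) N<k)))) (zeroˡ _))

  mono⊛mono : ∀ a b i j → mono a i ⊛ mono b j ≋ mono (a * b) (i +ℕ j)
  mono⊛mono a b i j N with i ≤? N
  ... | no i≰N = trans (mono⊛-< a i (mono b j) N (ℕP.≰⇒> i≰N))
    (sym (mono-miss (a * b) (i +ℕ j) N (λ N≡i+j → i≰N (≡.subst (i ≤_) (≡.sym N≡i+j) (ℕP.m≤m+n i j)))))
  ... | yes i≤N = trans (mono⊛-≥ a i (mono b j) N i≤N) (coefficient (N ℕ.≟ i +ℕ j))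
    where
    coefficient : Dec (N ≡ i +ℕ j) → a * mono b j (N ∸ i) ≈ mono (a * b) (i +ℕ j) N
    coefficient (yes ≡.refl) =
      trans (*-congˡ (≡.subst (λ m → mono b j m ≈ b) (≡.sym (ℕP.m+n∸m≡n i j)) (mono-hit b j)))
            (sym (mono-hit (a * b) (i +ℕ j)))
    coefficient (no N≢i+j) =
      trans (*-congˡ (mono-miss b j (N ∸ i) (λ N∸i≡j → N≢i+j (≡.trans (≡.sym (ℕP.m+[n∸m]≡n i≤N)) (≡.cong (i +ℕ_) N∸i≡j)))))
            (trans (zeroʳ a) (sym (mono-miss (a * b) (i +ℕ j) N N≢i+j)))

  0ˢ : Series
  0ˢ N = 0#

  -ˢ_ : Series → Series
  (-ˢ f) N = - f N

  ≋-isEquivalence : IsEquivalence _≋_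
  ≋-isEquivalence = record
    { refl  = λ N → refl
    ; sym   = λ f≋g N → sym (f≋g N)
    ; trans = λ f≋g g≋h N → trans (f≋g N) (g≋h N)
    }

  ⊛-cong : ∀ {f f′ g g′} → f ≋ f′ → g ≋ g′ → f ⊛ g ≋ f′ ⊛ g′
  ⊛-cong f≋f′ g≋g′ N = sumTo-cong′ (suc N) (λ i → *-cong (f≋f′ i) (g≋g′ (N ∸ i)))

  ⊛-comm : ∀ f g → f ⊛ g ≋ g ⊛ f
  ⊛-comm f g N = trans (sumTo-reverse (suc N) _) (sumTo-cong (suc N) swapped)
    where
    swapped : ∀ i → i < suc N → f (N ∸ i) * g (N ∸ (N ∸ i)) ≈ g i * f (N ∸ i)
    swapped i i<1+N rewrite ℕP.m∸[m∸n]≡n (ℕP.≤-pred i<1+N) = *-comm _ _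

  ⊛-assoc : ∀ f g h → (f ⊛ g) ⊛ h ≋ f ⊛ (g ⊛ h)
  ⊛-assoc f g h N = begin
    sumTo (suc N) (λ i → sumTo (suc i) (λ j → f j * g (i ∸ j)) * h (N ∸ i))
      ≈⟨ sumTo-cong′ (suc N) (λ i → sumTo-*ʳ (suc i) (h (N ∸ i)) _) ⟩
    sumTo (suc N) (λ i → sumTo (suc i) (λ j → (f j * g (i ∸ j)) * h (N ∸ i)))
      ≈⟨ sumTo-triangle (suc N) (λ i j → (f j * g (i ∸ j)) * h (N ∸ i)) ⟩
    sumTo (suc N) (λ j → sumTo (suc N ∸ j) (λ k → (f j * g ((j +ℕ k) ∸ j)) * h (N ∸ (j +ℕ k))))
      ≈⟨ sumTo-cong (suc N) row ⟩
    sumTo (suc N) (λ j → f j * sumTo (suc (N ∸ j)) (λ k → g k * h ((N ∸ j) ∸ k))) ∎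
    where
    term : ∀ j k → (f j * g ((j +ℕ k) ∸ j)) * h (N ∸ (j +ℕ k)) ≈ f j * (g k * h ((N ∸ j) ∸ k))
    term j k rewrite ℕP.m+n∸m≡n j k | ≡.sym (ℕP.∸-+-assoc N j k) = *-assoc _ _ _
    row : ∀ j → j < suc N → sumTo (suc N ∸ j) (λ k → (f j * g ((j +ℕ k) ∸ j)) * h (N ∸ (j +ℕ k)))
                            ≈ f j * sumTo (suc (N ∸ j)) (λ k → g k * h ((N ∸ j) ∸ k))
    row j j<1+N rewrite ℕP.+-∸-assoc 1 (ℕP.≤-pred j<1+N) =
      trans (sumTo-cong′ (suc (N ∸ j)) (term j)) (sym (sumTo-*ˡ (suc (N ∸ j)) (f j) _))

  ⊛-distribˡ : ∀ f g h → f ⊛ (g ⊕ h) ≋ (f ⊛ g) ⊕ (f ⊛ h)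
  ⊛-distribˡ f g h N = trans (sumTo-cong′ (suc N) (λ i → distribˡ _ _ _)) (sumTo-+ (suc N) _ _)

  one⊛ : ∀ f → one ⊛ f ≋ f
  one⊛ f N = trans (mono⊛-≥ 1# 0 f N z≤n) (*-identityˡ _)

  seriesRing : CommutativeRing c ℓ
  seriesRing = record
    { Carrier = Series ; _≈_ = _≋_ ; _+_ = _⊕_ ; _*_ = _⊛_ ; -_ = -ˢ_ ; 0# = 0ˢ ; 1# = one
    ; isCommutativeRing = record
      { isRing = record
        { +-isAbelianGroup = record
          { isGroup = record
            { isMonoid = record
              { isSemigroup = record
                { isMagma = record { isEquivalence = ≋-isEquivalence ; ∙-cong = λ e e′ N → +-cong (e N) (e′ N) }
                ; assoc = λ f g h N → +-assoc _ _ _ }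
              ; identity = (λ f N → +-identityˡ _) , (λ f N → +-identityʳ _) }
            ; inverse = (λ f N → -‿inverseˡ _) , (λ f N → -‿inverseʳ _)
            ; ⁻¹-cong = λ e N → -‿cong (e N) }
          ; comm = λ f g N → +-comm _ _ }
        ; *-cong = ⊛-cong
        ; *-assoc = ⊛-assoc
        ; *-identity = one⊛ , (λ f N → trans (⊛-comm f one N) (one⊛ f N))
        ; distrib = ⊛-distribˡ , (λ f g h N → trans (⊛-comm (g ⊕ h) f N) (trans (⊛-distribˡ f g h N)
                                    (+-cong (⊛-comm f g N) (⊛-comm f h N)))) }
      ; *-comm = ⊛-comm } }

  inv-top : ∀ f N → inv f (suc N) ≡ - sumTo (suc N) (λ i → f (suc i) * invTable f N (N ∸ i))
  inv-top f N with suc N ≤? N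
  ... | yes 1+N≤N = ⊥-elim (ℕP.<-irrefl ≡.refl 1+N≤N)
  ... | no _      = ≡.refl

  invTable-stable : ∀ f N j → j ≤ N → invTable f N j ≡ inv f j
  invTable-stable f zero    .zero z≤n = ≡.refl
  invTable-stable f (suc N) j j≤1+N with j ≤? N
  ... | yes j≤N = invTable-stable f N j j≤N
  ... | no j≰N  = ≡.trans (≡.sym (inv-top f N)) (≡.cong (inv f) (≡.sym (ℕP.≤-antisym j≤1+N (ℕP.≰⇒> j≰N))))

  inv-recurrence : ∀ f N → inv f (suc N) ≈ - sumTo (suc N) (λ i → f (suc i) * inv f (N ∸ i))
  inv-recurrence f N = trans (reflexive (inv-top f N))
    (-‿cong (sumTo-cong′ (suc N) (λ i → *-congˡ (reflexive (invTable-stable f N (N ∸ i) (ℕP.m∸n≤m N i))))))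

  ⊛-inv : ∀ g → g 0 ≈ 1# → g ⊛ inv g ≋ one
  ⊛-inv g g₀≈1 zero = trans (+-identityˡ _) (trans (*-cong g₀≈1 refl) (trans (*-identityˡ 1#) (sym (mono-hit 1# 0))))
  ⊛-inv g g₀≈1 (suc M) = begin
    sumTo (suc (suc M)) (λ i → g i * inv g (suc M ∸ i))    ≈⟨ sumTo-first (suc M) _ ⟩
    g 0 * inv g (suc M) + Σ                                  ≈⟨ +-congʳ (*-cong g₀≈1 (inv-recurrence g M)) ⟩
    1# * (- Σ) + Σ                                           ≈⟨ +-congʳ (*-identityˡ _) ⟩
    - Σ + Σ                                                  ≈⟨ -‿inverseˡ _ ⟩
    0#                                                       ≈⟨ mono-miss 1# 0 (suc M) (λ ()) ⟨
    one (suc M)                                              ∎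
    where Σ = sumTo (suc M) (λ i → g (suc i) * inv g (M ∸ i))

  Ord : ℕ → Series → Set ℓ
  Ord k f = ∀ N → N < k → f N ≈ 0#

  Ord-≋ : ∀ {k f g} → f ≋ g → Ord k f → Ord k g
  Ord-≋ f≋g ord N N<k = trans (sym (f≋g N)) (ord N N<k)

  Ord-weaken : ∀ {m k f} → m ≤ k → Ord k f → Ord m f
  Ord-weaken m≤k ord N N<m = ord N (ℕP.<-≤-trans N<m m≤k)

  Ord-⊛ : ∀ {i j f g} → Ord i f → Ord j g → Ord (i +ℕ j) (f ⊛ g)
  Ord-⊛ {i} {j} {f} {g} ord-f ord-g N N<i+j = sumTo-zero (suc N) term
    where
    term : ∀ m → m < suc N → f m * g (N ∸ m) ≈ 0#
    term m m≤N with m <? i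
    ... | yes m<i = trans (*-congʳ (ord-f m m<i)) (zeroˡ _)
    ... | no m≮i  = trans (*-congˡ (ord-g (N ∸ m) N∸m<j)) (zeroʳ _)
      where
      i≤m = ℕP.≮⇒≥ m≮i
      N∸i<j : N ∸ i < j
      N∸i<j = ℕP.+-cancelˡ-< i (N ∸ i) j
        (≡.subst (_< i +ℕ j) (≡.sym (ℕP.m+[n∸m]≡n (ℕP.≤-trans i≤m (ℕP.≤-pred m≤N)))) N<i+j)
      N∸m<j = ℕP.≤-<-trans (ℕP.∸-monoʳ-≤ N i≤m) N∸i<j

  Ord-⊛ˡ : ∀ {k} f {g} → Ord k g → Ord k (f ⊛ g)
  Ord-⊛ˡ f = Ord-⊛ {0} (λ _ ())

  Ord-⊛ʳ : ∀ {k f} g → Ord k f → Ord k (f ⊛ g)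
  Ord-⊛ʳ g ord = Ord-≋ (⊛-comm g _) (Ord-⊛ˡ g ord)

  Ord-mono : ∀ a k → Ord k (mono a k)
  Ord-mono a k N N<k = mono-miss a k N (λ N≡k → ℕP.<-irrefl N≡k N<k)

  Ord-^ : ∀ {f} n → Ord 1 f → Ord n (f ^ˢ n)
  Ord-^ zero    ord = λ _ ()
  Ord-^ (suc n) ord = Ord-⊛ ord (Ord-^ n ord)

  Ord-∞ : ∀ {f} → (∀ k → Ord k f) → f ≋ 0ˢ
  Ord-∞ ord N = ord (suc N) N ℕP.≤-refl

  Summable : (ℕ → Series) → Set ℓ
  Summable F = ∀ n → Ord n (F n)

  sumSeries-truncate : ∀ F → Summable F → ∀ N M → N < M → sumSeries F N ≈ sumTo M (λ n → F n N)
  sumSeries-truncate F summable N M N<M = sym (sumTo-extend≤ N<M (λ n N<n → summable n N N<n))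

  sumSeries-cong : ∀ {F G} → (∀ n → F n ≋ G n) → sumSeries F ≋ sumSeries G
  sumSeries-cong F≋G N = sumTo-cong′ (suc N) (λ n → F≋G n N)

  sumSeries-⊕ : ∀ F G → sumSeries (λ n → F n ⊕ G n) ≋ sumSeries F ⊕ sumSeries G
  sumSeries-⊕ F G N = sumTo-+ (suc N) _ _

  sumSeries-⊛ : ∀ g F → Summable F → g ⊛ sumSeries F ≋ sumSeries (λ n → g ⊛ F n)
  sumSeries-⊛ g F summable N = begin
    sumTo (suc N) (λ i → g i * sumTo (suc (N ∸ i)) (λ n → F n (N ∸ i)))
      ≈⟨ sumTo-cong′ (suc N) (λ i → *-congˡ (sumSeries-truncate F summable (N ∸ i) (suc N) (s≤s (ℕP.m∸n≤m N i)))) ⟩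
    sumTo (suc N) (λ i → g i * sumTo (suc N) (λ n → F n (N ∸ i)))
      ≈⟨ sumTo-cong′ (suc N) (λ i → sumTo-*ˡ (suc N) (g i) _) ⟩
    sumTo (suc N) (λ i → sumTo (suc N) (λ n → g i * F n (N ∸ i)))
      ≈⟨ sumTo-swap (suc N) (suc N) _ ⟩
    sumTo (suc N) (λ n → sumTo (suc N) (λ i → g i * F n (N ∸ i))) ∎

  sumSeries-first : ∀ F → Summable F → sumSeries F ≋ F 0 ⊕ sumSeries (λ n → F (suc n))
  sumSeries-first F summable N =
    trans (sumSeries-truncate F summable N (suc (suc N)) (ℕP.m<n⇒m<1+n (ℕP.n<1+n N))) (sumTo-first (suc N) _)

module SeriesAlgebra {c ℓ} (R : CommutativeRing c ℓ) where
  open PowerSeries R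
  open PowerSeriesRing R
  module K = CommutativeRing R
  module S = CommutativeRing seriesRing
  module KP = RingProperties K.ring
  open CommutativeRingFacts seriesRing
  open SetoidReasoning S.setoid

  Ord-q : Ord 1 q
  Ord-q = Ord-mono K.1# 1

  -- congruence in one factor, the other factor given explicitly since it
  -- cannot be recovered from a pointwise equation
  ⊛-congˡ : ∀ f {g g′} → g ≋ g′ → f ⊛ g ≋ f ⊛ g′
  ⊛-congˡ f = ⊛-cong {f} {f} S.refl

  ⊛-congʳ : ∀ g {f f′} → f ≋ f′ → f ⊛ g ≋ f′ ⊛ g
  ⊛-congʳ g f≋f′ = ⊛-cong {g = g} {g′ = g} f≋f′ S.refl

  ⊖-congˡ : ∀ f {g g′} → g ≋ g′ → f ⊖ g ≋ f ⊖ g′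
  ⊖-congˡ f g≋g′ N = K.+-congˡ (K.-‿cong (g≋g′ N))

  ·-cong : ∀ {a b f g} → a K.≈ b → f ≋ g → a · f ≋ b · g
  ·-cong a≈b f≋g N = K.*-cong a≈b (f≋g N)

  ·-⊛ˡ : ∀ a f g → (a · f) ⊛ g ≋ a · (f ⊛ g)
  ·-⊛ˡ a f g N = K.trans (sumTo-cong′ (suc N) (λ i → K.*-assoc a (f i) _)) (K.sym (sumTo-*ˡ (suc N) a _))

  ·-⊛ʳ : ∀ a f g → f ⊛ (a · g) ≋ a · (f ⊛ g)
  ·-⊛ʳ a f g = S.trans (⊛-comm f (a · g)) (S.trans (·-⊛ˡ a g f) (·-cong K.refl (⊛-comm g f)))

  ·-· : ∀ a b f → a · (b · f) ≋ (a K.* b) · f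
  ·-· a b f N = K.sym (K.*-assoc a b (f N))

  -‿· : ∀ a f → -ˢ (a · f) ≋ (K.- a) · f
  -‿· a f N = KP.-‿distribˡ-* a (f N)

  ·-identityˡ : ∀ f → K.1# · f ≋ f
  ·-identityˡ f N = K.*-identityˡ (f N)

  Ord-· : ∀ {k} a f → Ord k f → Ord k (a · f)
  Ord-· a f ord N N<k = K.trans (K.*-congˡ (ord N N<k)) (K.zeroʳ a)

  ^-congˡ : ∀ n {f g} → f ≋ g → f ^ˢ n ≋ g ^ˢ n
  ^-congˡ zero    f≋g = S.refl
  ^-congˡ (suc n) f≋g = S.*-cong f≋g (^-congˡ n f≋g)

  ^-distrib-⊛ : ∀ f g n → (f ⊛ g) ^ˢ n ≋ f ^ˢ n ⊛ g ^ˢ n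
  ^-distrib-⊛ f g zero    = S.sym (S.*-identityˡ one)
  ^-distrib-⊛ f g (suc n) = S.trans (S.*-congˡ (^-distrib-⊛ f g n)) (*-interchange f g (f ^ˢ n) (g ^ˢ n))

  ^-+ : ∀ f m n → f ^ˢ (m +ℕ n) ≋ f ^ˢ m ⊛ f ^ˢ n
  ^-+ f zero    n = S.sym (S.*-identityˡ (f ^ˢ n))
  ^-+ f (suc m) n = S.trans (S.*-congˡ (^-+ f m n)) (S.sym (S.*-assoc f (f ^ˢ m) (f ^ˢ n)))

  ^-* : ∀ f m n → (f ^ˢ m) ^ˢ n ≋ f ^ˢ (m *ℕ n)
  ^-* f m zero    rewrite ℕP.*-zeroʳ m = S.refl
  ^-* f m (suc n) rewrite ℕP.*-suc m n = S.trans (S.*-congˡ (^-* f m n)) (S.sym (^-+ f m (m *ℕ n)))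

  ·one : ∀ a → a · one ≋ mono a 0
  ·one a N with N ℕ.≟ 0
  ... | yes _ = K.*-identityʳ a
  ... | no _  = K.zeroʳ a

  mono-^ : ∀ a k n → mono a k ^ˢ n ≋ mono (pow a n) (n *ℕ k)
  mono-^ a k zero    = S.refl
  mono-^ a k (suc n) = S.trans (S.*-congˡ (mono-^ a k n)) (mono⊛mono a (pow a n) k (n *ℕ k))

  pow-one : ∀ n → pow K.1# n K.≈ K.1#
  pow-one zero    = K.refl
  pow-one (suc n) = K.trans (K.*-identityˡ _) (pow-one n)

  pow-double : ∀ a n → pow a (2 *ℕ n) K.≈ pow (a K.* a) n
  pow-double a zero    = K.refl
  pow-double a (suc n) = K.trans (K.reflexive (≡.cong (pow a) (ℕP.*-suc 2 n)))
    (K.trans (K.sym (K.*-assoc a a _)) (K.*-congˡ (pow-double a n)))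

  scalar-power-monomial : ∀ a n k → (a · one) ^ˢ n ⊛ q ^ˢ k ≋ mono (pow a n) k
  scalar-power-monomial a n k = begin
    (a · one) ^ˢ n ⊛ q ^ˢ k                          ≈⟨ S.*-cong (S.trans (^-congˡ n (·one a)) (mono-^ a 0 n)) (mono-^ K.1# 1 k) ⟩
    mono (pow a n) (n *ℕ 0) ⊛ mono (pow K.1# k) (k *ℕ 1) ≈⟨ mono⊛mono (pow a n) (pow K.1# k) (n *ℕ 0) (k *ℕ 1) ⟩
    mono (pow a n K.* pow K.1# k) (n *ℕ 0 +ℕ k *ℕ 1)    ≈⟨ mono-cong _ (K.trans (K.*-congˡ (pow-one k)) (K.*-identityʳ _)) ⟩
    mono (pow a n) (n *ℕ 0 +ℕ k *ℕ 1)                   ≡⟨ ≡.cong (mono (pow a n)) exponent ⟩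
    mono (pow a n) k                                     ∎
    where
    exponent : n *ℕ 0 +ℕ k *ℕ 1 ≡ k
    exponent rewrite ℕP.*-zeroʳ n | ℕP.*-identityʳ k = ≡.refl

  Unit : Series → Set ℓ
  Unit f = f 0 K.≈ K.1#

  ⊛-constant : ∀ f g → (f ⊛ g) 0 K.≈ f 0 K.* g 0
  ⊛-constant f g = K.+-identityˡ _

  Unit-⊛ : ∀ f g → Unit f → Unit g → Unit (f ⊛ g)
  Unit-⊛ f g uf ug = K.trans (⊛-constant f g) (K.trans (K.*-cong uf ug) (K.*-identityˡ K.1#))

  Unit-≋ : ∀ {f g} → f ≋ g → Unit f → Unit g
  Unit-≋ f≋g uf = K.trans (K.sym (f≋g 0)) uf

  Unit-1- : ∀ f → Ord 1 f → Unit (one ⊖ f)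
  Unit-1- f ord = K.trans (K.+-cong (mono-hit K.1# 0) (K.trans (K.-‿cong (ord 0 (s≤s z≤n))) KP.-0#≈0#)) (K.+-identityʳ K.1#)

  Unit-poch : ∀ a b n → Ord 1 a → Unit (poch a b n)
  Unit-poch a b zero    ord = mono-hit K.1# 0
  Unit-poch a b (suc n) ord = Unit-⊛ (poch a b n) (one ⊖ a ⊛ b ^ˢ n) (Unit-poch a b n ord) (Unit-1- (a ⊛ b ^ˢ n) (Ord-⊛ʳ (b ^ˢ n) ord))

  poch-cong : ∀ {a a′} b n → a ≋ a′ → poch a b n ≋ poch a′ b n
  poch-cong b zero    a≋a′ = S.refl
  poch-cong b (suc n) a≋a′ = S.*-cong (poch-cong b n a≋a′) (⊖-congˡ one (⊛-congʳ (b ^ˢ n) a≋a′))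

  poch-peel : ∀ a b n → poch a b (suc n) ≋ (one ⊖ a) ⊛ poch (a ⊛ b) b n
  poch-peel a b zero = begin
    one ⊛ (one ⊖ a ⊛ one)   ≈⟨ S.*-identityˡ (one ⊖ a ⊛ one) ⟩
    one ⊖ a ⊛ one           ≈⟨ ⊖-congˡ one (S.*-identityʳ a) ⟩
    one ⊖ a                 ≈⟨ S.*-identityʳ (one ⊖ a) ⟨
    (one ⊖ a) ⊛ one         ∎
  poch-peel a b (suc n) = begin
    poch a b (suc n) ⊛ (one ⊖ a ⊛ (b ⊛ b ^ˢ n))
      ≈⟨ S.*-cong (poch-peel a b n) (⊖-congˡ one (S.sym (S.*-assoc a b (b ^ˢ n)))) ⟩
    ((one ⊖ a) ⊛ poch (a ⊛ b) b n) ⊛ (one ⊖ (a ⊛ b) ⊛ b ^ˢ n)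
      ≈⟨ S.*-assoc (one ⊖ a) (poch (a ⊛ b) b n) (one ⊖ (a ⊛ b) ⊛ b ^ˢ n) ⟩
    (one ⊖ a) ⊛ poch (a ⊛ b) b (suc n) ∎

  inv-unique : ∀ P h → Unit P → P ⊛ h ≋ one → h ≋ inv P
  inv-unique P h uP P⊛h≈1 = begin
    h                   ≈⟨ S.*-identityʳ h ⟨
    h ⊛ one             ≈⟨ S.*-congˡ (⊛-inv P uP) ⟨
    h ⊛ (P ⊛ inv P)     ≈⟨ S.*-assoc h P (inv P) ⟨
    (h ⊛ P) ⊛ inv P     ≈⟨ ⊛-congʳ (inv P) (S.trans (S.*-comm h P) P⊛h≈1) ⟩
    one ⊛ inv P         ≈⟨ S.*-identityˡ (inv P) ⟩
    inv P               ∎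

  inv-cong : ∀ {P P′} → Unit P → P ≋ P′ → inv P ≋ inv P′
  inv-cong {P} {P′} uP P≋P′ =
    inv-unique P′ (inv P) (Unit-≋ P≋P′ uP) (S.trans (⊛-congʳ (inv P) (S.sym P≋P′)) (⊛-inv P uP))

  ⊘-cong : ∀ {Y Y′ P P′} → Y ≋ Y′ → Unit P → P ≋ P′ → Y ⊘ P ≋ Y′ ⊘ P′
  ⊘-cong Y≋Y′ uP P≋P′ = S.*-cong Y≋Y′ (inv-cong uP P≋P′)

  ⊘-one : ∀ Y → Y ⊘ one ≋ Y
  ⊘-one Y = S.trans (S.*-congˡ (S.sym (inv-unique one one (mono-hit K.1# 0) (S.*-identityˡ one)))) (S.*-identityʳ Y)

  ⊘-peel : ∀ u P P′ Y → Unit u → Unit P → P′ ≋ u ⊛ P → u ⊛ (Y ⊘ P′) ≋ Y ⊘ P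
  ⊘-peel u P P′ Y uu uP P′≋uP = begin
    u ⊛ (Y ⊛ inv P′)   ≈⟨ x∙yz≈y∙xz u Y (inv P′) ⟩
    Y ⊛ (u ⊛ inv P′)   ≈⟨ S.*-congˡ (inv-unique P (u ⊛ inv P′) uP P⊛u⊛invP′≈1) ⟩
    Y ⊛ inv P          ∎
    where
    P⊛u⊛invP′≈1 : P ⊛ (u ⊛ inv P′) ≋ one
    P⊛u⊛invP′≈1 = begin
      P ⊛ (u ⊛ inv P′)   ≈⟨ S.*-assoc P u (inv P′) ⟨
      (P ⊛ u) ⊛ inv P′   ≈⟨ ⊛-congʳ (inv P′) (S.trans (S.*-comm P u) (S.sym P′≋uP)) ⟩
      P′ ⊛ inv P′        ≈⟨ ⊛-inv P′ (Unit-≋ (S.sym P′≋uP) (Unit-⊛ u P uu uP)) ⟩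
      one                ∎

  Ord-cancel-unit : ∀ {k} u D → Unit u → Ord k (u ⊛ D) → Ord k D
  Ord-cancel-unit u D uu ord = Ord-≋ D′≋D (Ord-⊛ˡ (inv u) ord)
    where
    D′≋D : inv u ⊛ (u ⊛ D) ≋ D
    D′≋D = S.trans (S.sym (S.*-assoc (inv u) u D))
             (S.trans (⊛-congʳ D (S.trans (S.*-comm (inv u) u) (⊛-inv u uu))) (S.*-identityˡ D))

  -- The
  -- difference D satisfies u(s)·D(s) = B(s)·D(σ s), so by induction on k
  -- every D(s) has order at least k.
  recurrence-unique : ∀ {i} {I : Set i} (σ : I → I) (u c B H₁ H₂ : I → Series) →
    (∀ s → Unit (u s)) → (∀ s → Ord 1 (B s)) →
    (∀ s → u s ⊛ H₁ s ≋ c s ⊕ B s ⊛ H₁ (σ s)) →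
    (∀ s → u s ⊛ H₂ s ≋ c s ⊕ B s ⊛ H₂ (σ s)) →
    ∀ s → H₁ s ≋ H₂ s
  recurrence-unique σ u c B H₁ H₂ unit ord-B eq₁ eq₂ s =
    x∙y⁻¹≈ε⇒x≈y (H₁ s) (H₂ s) (Ord-∞ (λ k → Ord-difference k s))
    where
    difference : ∀ s → u s ⊛ (H₁ s ⊖ H₂ s) ≋ B s ⊛ (H₁ (σ s) ⊖ H₂ (σ s))
    difference s = difference-of-solutions {u s} {c s} {B s} {H₁ s} {H₁ (σ s)} {H₂ s} {H₂ (σ s)} (eq₁ s) (eq₂ s)
    Ord-difference : ∀ k s → Ord k (H₁ s ⊖ H₂ s)
    Ord-difference zero    s = λ _ ()
    Ord-difference (suc k) s = Ord-cancel-unit (u s) _ (unit s)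
      (Ord-≋ (S.sym (difference s)) (Ord-⊛ (ord-B s) (Ord-difference k (σ s))))

-- Both sides are evaluated at every q²-dilation: s plays the role of
-- q^{2k}, and σ s = s q² passes to the next dilation.

module MasterIdentity {c ℓ} (R : CommutativeRing c ℓ) where
  open PowerSeries R
  open PowerSeriesRing R
  open SeriesAlgebra R
  open CommutativeRingFacts seriesRing using (collect-term; expand-factor; x∙yz≈y∙xz)
  open SetoidReasoning S.setoid

  q² : Series
  q² = q ^ˢ 2

  q⊛q⊛s : ∀ s → q ⊛ (q ⊛ s) ≋ s ⊛ q²
  q⊛q⊛s s = S.trans (S.sym (S.*-assoc q q s)) (S.trans (S.*-comm (q ⊛ q) s) (⊛-congˡ s (⊛-congˡ q (S.sym (S.*-identityʳ q)))))

  module Dilated (b α a : K.Carrier) (αb≈a : α K.* b K.≈ a) where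

    σ : Series → Series
    σ s = s ⊛ q²

    X : Series → Series
    X s = (b · q) ⊛ s

    B : Series → Series
    B s = a · σ s

    lhsTerm : Series → ℕ → Series
    lhsTerm s n = ((a · s) ^ˢ n ⊛ q ^ˢ (n *ℕ n +ℕ n)) ⊘ poch (X s) q² (suc n)

    rhsTerm : Series → ℕ → Series
    rhsTerm s n = poch ((K.- α) · q) q² n ⊛ X s ^ˢ n

    lhs rhs : Series → Series
    lhs s = sumSeries (lhsTerm s)
    rhs s = sumSeries (rhsTerm s)

    Ord-X : ∀ s → Ord 1 (X s)
    Ord-X s = Ord-⊛ʳ s (Ord-· b q Ord-q)

    Ord-B : ∀ s → Ord 1 (B s)
    Ord-B s = Ord-· a (σ s) (Ord-⊛ˡ s (Ord-weaken (s≤s z≤n) (Ord-^ 2 Ord-q)))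

    Unit-1-X : ∀ s → Unit (one ⊖ X s)
    Unit-1-X s = Unit-1- (X s) (Ord-X s)

    lhs-summable : ∀ s → Summable (lhsTerm s)
    lhs-summable s n = Ord-⊛ʳ (inv (poch (X s) q² (suc n)))
      (Ord-⊛ˡ ((a · s) ^ˢ n) (Ord-weaken (ℕP.m≤n+m n (n *ℕ n)) (Ord-^ (n *ℕ n +ℕ n) Ord-q)))

    rhs-summable : ∀ s → Summable (rhsTerm s)
    rhs-summable s n = Ord-⊛ˡ (poch ((K.- α) · q) q² n) (Ord-^ n (Ord-X s))

    numerator-step : ∀ s n →
      (a · s) ^ˢ suc n ⊛ q ^ˢ (suc n *ℕ suc n +ℕ suc n) ≋ B s ⊛ ((a · σ s) ^ˢ n ⊛ q ^ˢ (n *ℕ n +ℕ n))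
    numerator-step s n = S.sym (begin
      B s ⊛ ((a · σ s) ^ˢ n ⊛ Q)            ≈⟨ S.*-cong as⊛q² (⊛-congʳ Q (^-congˡ n as⊛q²)) ⟩
      (V ⊛ q²) ⊛ ((V ⊛ q²) ^ˢ n ⊛ Q)        ≈⟨ S.sym (S.*-assoc (V ⊛ q²) ((V ⊛ q²) ^ˢ n) Q) ⟩
      (V ⊛ q²) ^ˢ suc n ⊛ Q                 ≈⟨ ⊛-congʳ Q (^-distrib-⊛ V q² (suc n)) ⟩
      (V ^ˢ suc n ⊛ q² ^ˢ suc n) ⊛ Q        ≈⟨ S.*-assoc (V ^ˢ suc n) (q² ^ˢ suc n) Q ⟩
      V ^ˢ suc n ⊛ (q² ^ˢ suc n ⊛ Q)        ≈⟨ ⊛-congˡ (V ^ˢ suc n) q-exponents ⟩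
      V ^ˢ suc n ⊛ q ^ˢ (2 *ℕ suc n +ℕ (n *ℕ n +ℕ n))
        ≡⟨ ≡.cong (λ k → V ^ˢ suc n ⊛ q ^ˢ k) (exponent n) ⟩
      V ^ˢ suc n ⊛ q ^ˢ (suc n *ℕ suc n +ℕ suc n) ∎)
      where
      V = a · s
      Q = q ^ˢ (n *ℕ n +ℕ n)
      as⊛q² : a · σ s ≋ V ⊛ q²
      as⊛q² = S.sym (·-⊛ˡ a s q²)
      q-exponents : q² ^ˢ suc n ⊛ Q ≋ q ^ˢ (2 *ℕ suc n +ℕ (n *ℕ n +ℕ n))
      q-exponents = S.trans (⊛-congʳ Q (^-* q 2 (suc n))) (S.sym (^-+ q (2 *ℕ suc n) (n *ℕ n +ℕ n)))
      exponent : ∀ n → 2 *ℕ suc n +ℕ (n *ℕ n +ℕ n) ≡ suc n *ℕ suc n +ℕ suc n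
      exponent = solve-∀

    denominator-peel : ∀ s n Y →
      (one ⊖ X s) ⊛ (Y ⊘ poch (X s) q² (suc n)) ≋ Y ⊘ poch (X (σ s)) q² n
    denominator-peel s n Y = ⊘-peel (one ⊖ X s) (poch (X (σ s)) q² n) (poch (X s) q² (suc n)) Y
      (Unit-1-X s) (Unit-poch (X (σ s)) q² n (Ord-X (σ s)))
      (S.trans (poch-peel (X s) q² n) (⊛-congˡ (one ⊖ X s) (poch-cong q² n (S.*-assoc (b · q) s q²))))

    lhs-recurrence : ∀ s → (one ⊖ X s) ⊛ lhs s ≋ one ⊕ B s ⊛ lhs (σ s)
    lhs-recurrence s = begin
      u ⊛ lhs s                                           ≈⟨ sumSeries-⊛ u (lhsTerm s) (lhs-summable s) ⟩
      sumSeries (λ n → u ⊛ lhsTerm s n)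
        ≈⟨ sumSeries-first (λ n → u ⊛ lhsTerm s n) (λ n → Ord-⊛ˡ u (lhs-summable s n)) ⟩
      u ⊛ lhsTerm s 0 ⊕ sumSeries (λ n → u ⊛ lhsTerm s (suc n))
        ≈⟨ S.+-cong first-term (sumSeries-cong later-term) ⟩
      one ⊕ sumSeries (λ n → B s ⊛ lhsTerm (σ s) n)
        ≈⟨ S.+-congˡ (S.sym (sumSeries-⊛ (B s) (lhsTerm (σ s)) (lhs-summable (σ s)))) ⟩
      one ⊕ B s ⊛ lhs (σ s)                               ∎
      where
      u = one ⊖ X s
      first-term : u ⊛ lhsTerm s 0 ≋ one
      first-term = S.trans (denominator-peel s 0 (one ⊛ one)) (S.trans (⊘-one (one ⊛ one)) (S.*-identityˡ one))
      later-term : ∀ n → u ⊛ lhsTerm s (suc n) ≋ B s ⊛ lhsTerm (σ s) n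
      later-term n = begin
        u ⊛ lhsTerm s (suc n)                                   ≈⟨ denominator-peel s (suc n) _ ⟩
        ((a · s) ^ˢ suc n ⊛ q ^ˢ (suc n *ℕ suc n +ℕ suc n)) ⊘ P  ≈⟨ ⊛-congʳ (inv P) (numerator-step s n) ⟩
        (B s ⊛ ((a · σ s) ^ˢ n ⊛ q ^ˢ (n *ℕ n +ℕ n))) ⊘ P        ≈⟨ S.*-assoc (B s) _ (inv P) ⟩
        B s ⊛ lhsTerm (σ s) n                                   ∎
        where P = poch (X (σ s)) q² (suc n)

    key-product : ∀ s → -ˢ (((K.- α) · q) ⊛ X s) ≋ B s
    key-product s = begin
      -ˢ (((K.- α) · q) ⊛ X s)                ≈⟨ S.-‿cong (·-⊛ˡ (K.- α) q (X s)) ⟩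
      -ˢ ((K.- α) · (q ⊛ X s))                ≈⟨ -‿· (K.- α) (q ⊛ X s) ⟩
      (K.- (K.- α)) · (q ⊛ X s)               ≈⟨ ·-cong K.refl (S.trans (⊛-congˡ q (·-⊛ˡ b q s)) (·-⊛ʳ b q (q ⊛ s))) ⟩
      (K.- (K.- α)) · (b · (q ⊛ (q ⊛ s)))     ≈⟨ ·-· (K.- (K.- α)) b (q ⊛ (q ⊛ s)) ⟩
      ((K.- (K.- α)) K.* b) · (q ⊛ (q ⊛ s))   ≈⟨ ·-cong (K.trans (K.*-congʳ (KP.-‿involutive α)) αb≈a) (q⊛q⊛s s) ⟩
      B s                                     ∎

    rhs-term-step : ∀ s n → rhsTerm s (suc n) ≋ X s ⊛ rhsTerm s n ⊕ B s ⊛ rhsTerm (σ s) n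
    rhs-term-step s n = begin
      (C ⊛ (one ⊖ A ⊛ q² ^ˢ n)) ⊛ (X s ⊛ X s ^ˢ n)
        ≈⟨ expand-factor C A (q² ^ˢ n) (X s) (X s ^ˢ n) ⟩
      X s ⊛ (C ⊛ X s ^ˢ n) ⊕ C ⊛ ((-ˢ (A ⊛ X s)) ⊛ (q² ^ˢ n ⊛ X s ^ˢ n))
        ≈⟨ S.+-congˡ (⊛-congˡ C (S.*-cong (key-product s) dilated-power)) ⟩
      X s ⊛ rhsTerm s n ⊕ C ⊛ (B s ⊛ X (σ s) ^ˢ n)
        ≈⟨ S.+-congˡ (x∙yz≈y∙xz C (B s) (X (σ s) ^ˢ n)) ⟩
      X s ⊛ rhsTerm s n ⊕ B s ⊛ rhsTerm (σ s) n ∎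
      where
      A = (K.- α) · q
      C = poch A q² n
      dilated-power : q² ^ˢ n ⊛ X s ^ˢ n ≋ X (σ s) ^ˢ n
      dilated-power = S.trans (S.*-comm (q² ^ˢ n) (X s ^ˢ n))
        (S.trans (S.sym (^-distrib-⊛ (X s) q² n)) (^-congˡ n (S.*-assoc (b · q) s q²)))

    rhs-recurrence : ∀ s → (one ⊖ X s) ⊛ rhs s ≋ one ⊕ B s ⊛ rhs (σ s)
    rhs-recurrence s = collect-term {rhs s} {X s} {one} {B s} {rhs (σ s)} (begin
      rhs s                                                        ≈⟨ sumSeries-first (rhsTerm s) (rhs-summable s) ⟩
      rhsTerm s 0 ⊕ sumSeries (λ n → rhsTerm s (suc n))            ≈⟨ S.+-cong (S.*-identityˡ one) (sumSeries-cong (rhs-term-step s)) ⟩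
      one ⊕ sumSeries (λ n → X s ⊛ rhsTerm s n ⊕ B s ⊛ rhsTerm (σ s) n)
        ≈⟨ S.+-congˡ (sumSeries-⊕ (λ n → X s ⊛ rhsTerm s n) (λ n → B s ⊛ rhsTerm (σ s) n)) ⟩
      one ⊕ (sumSeries (λ n → X s ⊛ rhsTerm s n) ⊕ sumSeries (λ n → B s ⊛ rhsTerm (σ s) n))
        ≈⟨ S.+-congˡ (S.sym (S.+-cong (sumSeries-⊛ (X s) (rhsTerm s) (rhs-summable s))
                                      (sumSeries-⊛ (B s) (rhsTerm (σ s)) (rhs-summable (σ s))))) ⟩
      one ⊕ (X s ⊛ rhs s ⊕ B s ⊛ rhs (σ s))                        ≈⟨ S.sym (S.+-assoc one (X s ⊛ rhs s) _) ⟩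
      (one ⊕ X s ⊛ rhs s) ⊕ B s ⊛ rhs (σ s)                        ∎)

    lhs≋rhs : ∀ s → lhs s ≋ rhs s
    lhs≋rhs = recurrence-unique σ (λ s → one ⊖ X s) (λ _ → one) B lhs rhs
      Unit-1-X Ord-B lhs-recurrence rhs-recurrence

  master-identity : ∀ b α a → α K.* b K.≈ a →
    sumSeries (λ n → mono (pow a n) (n *ℕ n +ℕ n) ⊘ poch (b · q) q² (suc n))
      ≋ sumSeries (λ n → poch ((K.- α) · q) q² n ⊛ (b · q) ^ˢ n)
  master-identity b α a αb≈a = begin
    sumSeries (λ n → mono (pow a n) (n *ℕ n +ℕ n) ⊘ poch (b · q) q² (suc n))
      ≈⟨ sumSeries-cong (λ n → ⊘-cong (S.sym (scalar-power-monomial a n (n *ℕ n +ℕ n)))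
                                       (Unit-poch (b · q) q² (suc n) (Ord-· b q Ord-q))
                                       (poch-cong q² (suc n) (S.sym (S.*-identityʳ (b · q))))) ⟩
    lhs one   ≈⟨ lhs≋rhs one ⟩
    rhs one   ≈⟨ sumSeries-cong (λ n → ⊛-congˡ (poch ((K.- α) · q) q² n) (^-congˡ n (S.*-identityʳ (b · q)))) ⟩
    sumSeries (λ n → poch ((K.- α) · q) q² n ⊛ (b · q) ^ˢ n) ∎
    where open Dilated b α a αb≈a

module Instances {c ℓ} (R : CommutativeRing c ℓ) where
  open PowerSeries R
  open PowerSeriesRing R
  open SeriesAlgebra R
  open MasterIdentity R

  lhs-coefficients-cong : ∀ {f g : ℕ → K.Carrier} (P : ℕ → Series) → (∀ n → f n K.≈ g n) →
    sumSeries (λ n → mono (f n) (n *ℕ n +ℕ n) ⊘ P n) ≋ sumSeries (λ n → mono (g n) (n *ℕ n +ℕ n) ⊘ P n)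
  lhs-coefficients-cong P f≈g = sumSeries-cong (λ n → ⊛-congʳ (inv (P n)) (mono-cong (n *ℕ n +ℕ n) (f≈g n)))

  instance-b=1 : ∀ z →
    sumSeries (λ n → mono (pow z n) (n *ℕ n +ℕ n) ⊘ poch q q² (suc n))
      ≋ sumSeries (λ n → poch ((K.- z) · q) q² n ⊛ q ^ˢ n)
  instance-b=1 z = S.trans (sumSeries-cong (λ n → ⊘-cong S.refl (Unit-poch q q² (suc n) Ord-q) (poch-cong q² (suc n) (S.sym (·-identityˡ q)))))
    (S.trans (master-identity K.1# z z (K.*-identityʳ z))
             (sumSeries-cong (λ n → ⊛-congˡ (poch ((K.- z) · q) q² n) (^-congˡ n (·-identityˡ q)))))

  instance-α=1 : ∀ z →
    sumSeries (λ n → mono (pow z n) (n *ℕ n +ℕ n) ⊘ poch (z · q) q² (suc n))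
      ≋ sumSeries (λ n → poch ((K.- K.1#) · q) q² n ⊛ (z · q) ^ˢ n)
  instance-α=1 z = master-identity z K.1# z (K.*-identityˡ z)

  instance-a=1 : ∀ z w → z K.* w K.≈ K.1# →
    sumSeries (λ n → mono K.1# (n *ℕ n +ℕ n) ⊘ poch (z · q) q² (suc n))
      ≋ sumSeries (λ n → poch ((K.- w) · q) q² n ⊛ (z · q) ^ˢ n)
  instance-a=1 z w zw≈1 = S.trans (lhs-coefficients-cong (λ n → poch (z · q) q² (suc n)) (λ n → K.sym (pow-one n)))
    (master-identity z w K.1# (K.trans (K.*-comm w z) zw≈1))

  instance-α=z : ∀ z →
    sumSeries (λ n → mono (pow z (2 *ℕ n)) (n *ℕ n +ℕ n) ⊘ poch (z · q) q² (suc n))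
      ≋ sumSeries (λ n → poch ((K.- z) · q) q² n ⊛ (z · q) ^ˢ n)
  instance-α=z z = S.trans (lhs-coefficients-cong (λ n → poch (z · q) q² (suc n)) (pow-double z))
    (master-identity z z (z K.* z) K.refl)

open import Data.Nat using (_+_; _*_)

corollary1 : ∀ {c ℓ} (R : CommutativeRing c ℓ) →
    let open PowerSeries R in
    (z : Coeff) →
       (sumSeries (λ n → mono (pow z n) (n * n + n) ⊘ poch q (q ^ˢ 2) (suc n))
         ≋ sumSeries (λ n → poch ((-ᴿ z) · q) (q ^ˢ 2) n ⊛ (q ^ˢ n)))
     × (sumSeries (λ n → mono (pow z n) (n * n + n) ⊘ poch (z · q) (q ^ˢ 2) (suc n))
         ≋ sumSeries (λ n → poch ((-ᴿ 1ᴿ) · q) (q ^ˢ 2) n ⊛ ((z · q) ^ˢ n)))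
     × ((w : Coeff) → z *ᴿ w ≈ᴿ 1ᴿ →
         sumSeries (λ n → mono 1ᴿ (n * n + n) ⊘ poch (z · q) (q ^ˢ 2) (suc n))
           ≋ sumSeries (λ n → poch ((-ᴿ w) · q) (q ^ˢ 2) n ⊛ ((z · q) ^ˢ n)))
     × (sumSeries (λ n → mono (pow z (2 * n)) (n * n + n) ⊘ poch (z · q) (q ^ˢ 2) (suc n))
         ≋ sumSeries (λ n → poch ((-ᴿ z) · q) (q ^ˢ 2) n ⊛ ((z · q) ^ˢ n)))
corollary1 R z = instance-b=1 z , instance-α=1 z , instance-a=1 z , instance-α=z z
  where open Instances R
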